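{- Let $\mathfrak M$ be a model based on a finitely $\mathfrak M$-generated temporal descriptive frame $\mathfrak F=(W,R,\mathcal P)$. Then: (a) every degenerate cluster in $\mathfrak F$ is both maximal and minimal in $\mathfrak M$; (b) a cluster is maximal (minimal) in $\mathfrak M$ iff it is $R$-final (respectively, $R^-$-final) or has an immediate $R$-successor (respectively, an immediate $R^-$-successor); (c) a cluster is definable in $\mathfrak M$ iff it is both maximal and minimal in $\mathfrak M$. Consequently, $R$-limit and $R^-$-limit clusters are not definable and not degenerate, and all other clusters are definable in $\mathfrak M$. Moreover, (d) for any clusters $C<_RC'$ in $\mathfrak F$, the interval $[C,C']$ contains a maximal cluster and also a minimal one; (e) if $C$ is not an $R$-limit cluster and $C'$ is not an $R^-$-limit cluster, then the closed interval $[C,C']$ is definable in $\mathfrak M$.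
   Context: Temporal formulas: variables, $\top,\bot,\neg,\wedge,\Diamond_F,\Diamond_P$. A temporal frame $(W,R,\mathcal P)$: $R$ transitive and connected ($xRy\vee x=y\vee yRx$), $\mathcal P\subseteq2^W$ containing $\emptyset,W$ closed under $\cap$, complement, $\Diamond_FX=\{x\mid\exists y\in X\,xRy\}$, $\Diamond_PX=\{x\mid\exists y\in X\,yRx\}$; $\Diamond_F$ is interpreted by $R$, $\Diamond_P$ by the inverse $R^-$. Descriptive: (dif) distinct points separated by a set in $\mathcal P$; (tig) $xRy$ iff for all $X\in\mathcal P$, $y\in X\Rightarrow x\in\Diamond_FX$; (com) every subfamily of $\mathcal P$ with the finite intersection property has nonempty intersection. A model $\mathfrak M$ maps every variable to a set in $\mathcal P$; $X$ is definable in $\mathfrak M$ if it is the truth set of some temporal formula. $\mathfrak F$ is finitely $\mathfrak M$-generated if $\mathcal P$ is finitely generated (under Booleans, $\Diamond_F,\Diamond_P$) and every set in $\mathcal P$ is definable in $\mathfrak M$. Cluster $C(x)=\{x\}\cup\{y\mid xRy\wedge yRx\}$, degenerate if a single irreflexive point; $C(x)<_RC(y)$ iff $xRy$ and not $yRx$. $R$-final: no cluster above; $R^-$-final: no cluster below. $C'$ is an immediate $R$-successor of $C$ if $C<_RC'$ with nothing strictly between; an immediate $R^-$-successor of $C$ is a $C'$ with $C'<_RC$ and nothing strictly between. An $R$-limit cluster is a non-$R^-$-final cluster without an immediate $R^-$-successor; an $R^-$-limit cluster is a non-$R$-final cluster without an immediate $R$-successor. Closed interval $[C,C']$ = union of $C$,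 $C'$ and all clusters strictly between. For a set $\Gamma$ of formulas, $x$ is $\Gamma$-maximal in $\mathfrak M$ if $\mathfrak M,x\models\Gamma$ and whenever $xRy$ and $\mathfrak M,y\models\Gamma$ then $yRx$; $\Gamma$-minimal if $\mathfrak M,x\models\Gamma$ and whenever $yRx$ and $\mathfrak M,y\models\Gamma$ then $xRy$. A cluster is maximal (minimal) in $\mathfrak M$ if it contains a $\{\mu\}$-maximal ($\{\mu\}$-minimal) point for some formula $\mu$. -}

module Defs where

open import Data.Nat using (ℕ)
open import Data.Fin using (Fin)
open import Data.Empty using (⊥)
open import Data.Unit using (⊤)
open import Data.Product using (Σ; ∃; ∃-syntax; _×_; _,_)
open import Data.Sum using (_⊎_)
open import Data.List using (List)
open import Data.List.Relation.Unary.All using (All)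
open import Relation.Nullary using (¬_)
open import Relation.Binary.PropositionalEquality using (_≡_; _≢_)
open import Level using () renaming (suc to lsuc; zero to lzero)

data Fm (V : Set) : Set where
  var  : V → Fm V
  ⊤ᶠ   : Fm V
  ⊥ᶠ   : Fm V
  ¬ᶠ_  : Fm V → Fm V
  _∧ᶠ_ : Fm V → Fm V → Fm V
  ◇F   : Fm V → Fm V
  ◇P   : Fm V → Fm V

Sub : Set → Set₁
Sub W = W → Set

_≐_ : {W : Set} → Sub W → Sub W → Set
X ≐ Y = ∀ w → (X w → Y w) × (Y w → X w)

∅ˢ : {W : Set} → Sub W
∅ˢ _ = ⊥

Wˢ : {W : Set} → Sub W
Wˢ _ = ⊤

_∩ˢ_ : {W : Set} → Sub W → Sub W → Sub W
(X ∩ˢ Y) w = X w × Y w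

∁ˢ : {W : Set} → Sub W → Sub W
∁ˢ X w = ¬ X w

◇Fˢ : {W : Set} → (W → W → Set) → Sub W → Sub W
◇Fˢ R X x = ∃[ y ] (X y × R x y)

◇Pˢ : {W : Set} → (W → W → Set) → Sub W → Sub W
◇Pˢ R X x = ∃[ y ] (X y × R y x)

⟦_⟧ : {V W : Set} → Fm V → (W → W → Set) → (V → Sub W) → Sub W
⟦ var p ⟧   R v = v p
⟦ ⊤ᶠ ⟧      R v = Wˢ
⟦ ⊥ᶠ ⟧      R v = ∅ˢ
⟦ ¬ᶠ φ ⟧    R v = ∁ˢ (⟦ φ ⟧ R v)
⟦ φ ∧ᶠ ψ ⟧  R v = ⟦ φ ⟧ R v ∩ˢ ⟦ ψ ⟧ R v
⟦ ◇F φ ⟧    R v = ◇Fˢ R (⟦ φ ⟧ R v)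
⟦ ◇P φ ⟧    R v = ◇Pˢ R (⟦ φ ⟧ R v)

record TemporalFrame : Set₂ where
  field
    W : Set
    R : W → W → Set
    𝒫 : Sub W → Set₁
    𝒫-ext    : ∀ {X Y} → 𝒫 X → X ≐ Y → 𝒫 Y
    trans    : ∀ {x y z} → R x y → R y z → R x z
    connected : ∀ x y → R x y ⊎ (x ≡ y ⊎ R y x)
    𝒫-∅      : 𝒫 ∅ˢ
    𝒫-W      : 𝒫 Wˢ
    𝒫-∩      : ∀ {X Y} → 𝒫 X → 𝒫 Y → 𝒫 (X ∩ˢ Y)
    𝒫-∁      : ∀ {X} → 𝒫 X → 𝒫 (∁ˢ X)
    𝒫-◇F     : ∀ {X} → 𝒫 X → 𝒫 (◇Fˢ R X)
    𝒫-◇P     : ∀ {X} → 𝒫 X → 𝒫 (◇Pˢ R X)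

module Frame (𝔉 : TemporalFrame) where
  open TemporalFrame 𝔉

  FIP : (Sub W → Set₁) → Set₁
  FIP 𝒬 = (L : List (Sub W)) → All 𝒬 L → ∃[ x ] All (λ X → X x) L

  record Descriptive : Set₂ where
    field
      dif : ∀ x y → x ≢ y → ∃[ X ] (𝒫 X × X x × ¬ X y)
      tig : ∀ x y → (R x y → ∀ X → 𝒫 X → X y → ◇Fˢ R X x)
                  × ((∀ X → 𝒫 X → X y → ◇Fˢ R X x) → R x y)
      com : (𝒬 : Sub W → Set₁) → (∀ X → 𝒬 X → 𝒫 X) → FIP 𝒬
            → ∃[ x ] (∀ X → 𝒬 X → X x)

  record Model : Set₁ where
    field
      val   : ℕ → Sub W
      val∈𝒫 : ∀ p → 𝒫 (val p)

  module InModel (𝔐 : Model) where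
    open Model 𝔐

    ⟦_⟧ᴹ : Fm ℕ → Sub W
    ⟦ φ ⟧ᴹ = ⟦ φ ⟧ R val

    Definable : Sub W → Set
    Definable X = ∃[ φ ] (X ≐ ⟦ φ ⟧ᴹ)

    FinitelyGenerated : Set₁
    FinitelyGenerated =
      Σ ℕ λ n → Σ (Fin n → Sub W) λ g →
        (∀ i → 𝒫 (g i)) × (∀ X → 𝒫 X → ∃[ φ ] (X ≐ ⟦ φ ⟧ R g))

    FinitelyMGenerated : Set₁
    FinitelyMGenerated = FinitelyGenerated × (∀ X → 𝒫 X → Definable X)

    -- clusters (a cluster is represented by any of its points)

    Cluster : W → Sub W
    Cluster x y = (y ≡ x) ⊎ (R x y × R y x)

    Degenerate : W → Set
    Degenerate x = (∀ y → Cluster x y → y ≡ x) × ¬ R x x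

    _<C_ : W → W → Set
    x <C y = R x y × ¬ R y x

    RFinal : W → Set
    RFinal x = ¬ (∃[ y ] (x <C y))

    R⁻Final : W → Set
    R⁻Final x = ¬ (∃[ y ] (y <C x))

    ImmRSucc : W → W → Set
    ImmRSucc x y = x <C y × ¬ (∃[ z ] (x <C z × z <C y))

    ImmR⁻Succ : W → W → Set
    ImmR⁻Succ x y = y <C x × ¬ (∃[ z ] (y <C z × z <C x))

    HasImmRSucc : W → Set
    HasImmRSucc x = ∃[ y ] ImmRSucc x y

    HasImmR⁻Succ : W → Set
    HasImmR⁻Succ x = ∃[ y ] ImmR⁻Succ x y

    RLimit : W → Set
    RLimit x = ¬ R⁻Final x × ¬ HasImmR⁻Succ x

    R⁻Limit : W → Set
    R⁻Limit x = ¬ RFinal x × ¬ HasImmRSucc x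

    Interval : W → W → Sub W
    Interval x y z = Cluster x z ⊎ (Cluster y z ⊎ (x <C z × z <C y))

    MaximalPt : Fm ℕ → W → Set
    MaximalPt μ x = ⟦ μ ⟧ᴹ x × (∀ y → R x y → ⟦ μ ⟧ᴹ y → R y x)

    MinimalPt : Fm ℕ → W → Set
    MinimalPt μ x = ⟦ μ ⟧ᴹ x × (∀ y → R y x → ⟦ μ ⟧ᴹ y → R x y)

    MaximalCl : W → Set
    MaximalCl x = ∃[ y ] (Cluster x y × ∃[ μ ] MaximalPt μ y)

    MinimalCl : W → Set
    MinimalCl x = ∃[ y ] (Cluster x y × ∃[ μ ] MinimalPt μ y)

-- Compactness and tightness give maximal points: inside a 𝒫-set X, above any
-- X-point x there is an X-maximal point, namely a point of the intersection of
-- all 𝒫-sets that contain the part of X above some X-point (this family has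
-- the finite intersection property because R is connected).  As every 𝒫-set
-- is definable, a cluster is maximal iff it contains such a point.  If a ∈ C(x)
-- is μ-maximal, then μ ∨ ◇F μ defines the down-set of C(x), so the points
-- strictly after C(x) form a 𝒫-set, and a minimal point of it is an immediate
-- R-successor.  Conversely, a 𝒫-set containing x but separated from y by tig
-- and dif has its maximal points above x strictly below C(y); when C(y) is an
-- immediate successor they fall into C(x), and in general into [C(x), C(y)].
-- Minimality is maximality in the opposite frame, which is again descriptive
-- and interprets the mirror images of formulas.  Clusters and intervals are the
-- intersections of a definable up-set and a definable down-set.
module Submission where

open import Defs
open import Data.Product using (_×_; ∃-syntax)
open import Data.Sum using (_⊎_)
open import Relation.Nullary using (¬_)
open import Axiom.ExcludedMiddle using (ExcludedMiddle)
open import Level using () renaming (suc to lsuc; zero to lzero)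
open import Axiom.DoubleNegationElimination using (em⇒dne)
open import Data.Empty using (⊥-elim)
open import Data.List using (List; []; _∷_)
open import Data.List.Relation.Unary.All using (All; []; _∷_)
open import Data.Product using (_,_; proj₁; proj₂; swap)
import Data.Product as Product
open import Data.Sum using (inj₁; inj₂)
import Data.Sum as Sum
open import Data.Unit using (tt)
open import Function using (id; flip; _∘_)
open import Relation.Binary.Construct.Closure.Reflexive using (ReflClosure; refl; [_])
open import Relation.Binary.Construct.Closure.Reflexive.Properties using () renaming (trans to reflClosure-trans)
open import Relation.Binary.PropositionalEquality using (refl; sym)
open import Relation.Nullary using (yes; no)

≐-sym : {W : Set} {X Y : Sub W} → X ≐ Y → Y ≐ X
≐-sym X≐Y w = swap (X≐Y w)

≐-trans : {W : Set} {X Y Z : Sub W} → X ≐ Y → Y ≐ Z → X ≐ Z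
≐-trans X≐Y Y≐Z w = proj₁ (Y≐Z w) ∘ proj₁ (X≐Y w) , proj₂ (X≐Y w) ∘ proj₂ (Y≐Z w)

reflClosure-flip : {A : Set} {R : A → A → Set} {x y : A} →
                   ReflClosure (flip R) x y → ReflClosure R y x
reflClosure-flip refl    = refl
reflClosure-flip [ yRx ] = [ yRx ]

mirror : {V : Set} → Fm V → Fm V
mirror (var p)  = var p
mirror ⊤ᶠ       = ⊤ᶠ
mirror ⊥ᶠ       = ⊥ᶠ
mirror (¬ᶠ φ)   = ¬ᶠ mirror φ
mirror (φ ∧ᶠ ψ) = mirror φ ∧ᶠ mirror ψ
mirror (◇F φ)   = ◇P (mirror φ)
mirror (◇P φ)   = ◇F (mirror φ)

⟦mirror⟧ : {V W : Set} (φ : Fm V) (R : W → W → Set) (v : V → Sub W) →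
           ⟦ φ ⟧ (flip R) v ≐ ⟦ mirror φ ⟧ R v
⟦mirror⟧ (var p)  R v w = id , id
⟦mirror⟧ ⊤ᶠ       R v w = id , id
⟦mirror⟧ ⊥ᶠ       R v w = id , id
⟦mirror⟧ (¬ᶠ φ)   R v w = (λ ¬a → ¬a ∘ proj₂ (⟦mirror⟧ φ R v w))
                        , (λ ¬b → ¬b ∘ proj₁ (⟦mirror⟧ φ R v w))
⟦mirror⟧ (φ ∧ᶠ ψ) R v w = Product.map (proj₁ (⟦mirror⟧ φ R v w)) (proj₁ (⟦mirror⟧ ψ R v w))
                        , Product.map (proj₂ (⟦mirror⟧ φ R v w)) (proj₂ (⟦mirror⟧ ψ R v w))
⟦mirror⟧ (◇F φ)   R v w = (λ (y , φy , r) → y , proj₁ (⟦mirror⟧ φ R v y) φy , r)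
                        , (λ (y , φy , r) → y , proj₂ (⟦mirror⟧ φ R v y) φy , r)
⟦mirror⟧ (◇P φ)   R v w = (λ (y , φy , r) → y , proj₁ (⟦mirror⟧ φ R v y) φy , r)
                        , (λ (y , φy , r) → y , proj₂ (⟦mirror⟧ φ R v y) φy , r)

◇F⁼ : {V : Set} → Fm V → Fm V
◇F⁼ φ = ¬ᶠ ((¬ᶠ φ) ∧ᶠ (¬ᶠ ◇F φ))

opposite : TemporalFrame → TemporalFrame
opposite 𝔉 = record
  { W = W ; R = flip R ; 𝒫 = 𝒫 ; 𝒫-ext = 𝒫-ext
  ; trans = λ xRy yRz → trans yRz xRy
  ; connected = λ x y → Sum.map₂ (Sum.map₁ sym) (connected y x)
  ; 𝒫-∅ = 𝒫-∅ ; 𝒫-W = 𝒫-W ; 𝒫-∩ = 𝒫-∩ ; 𝒫-∁ = 𝒫-∁ ; 𝒫-◇F = 𝒫-◇P ; 𝒫-◇P = 𝒫-◇F }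
  where open TemporalFrame 𝔉

opposite-model : {𝔉 : TemporalFrame} → Frame.Model 𝔉 → Frame.Model (opposite 𝔉)
opposite-model 𝔐 = record { val = val ; val∈𝒫 = val∈𝒫 }
  where open Frame.Model 𝔐

module Order (𝔉 : TemporalFrame) where
  open TemporalFrame 𝔉

  infix 4 _≼_
  _≼_ : W → W → Set
  _≼_ = ReflClosure R

  ≼-trans : ∀ {x y z} → x ≼ y → y ≼ z → x ≼ z
  ≼-trans = reflClosure-trans trans

  ≼-R-trans : ∀ {x y z} → x ≼ y → R y z → R x z
  ≼-R-trans refl    yRz = yRz
  ≼-R-trans [ xRy ] yRz = trans xRy yRz

  R-≼-trans : ∀ {x y z} → R x y → y ≼ z → R x z
  R-≼-trans xRy refl    = xRy
  R-≼-trans xRy [ yRz ] = trans xRy yRz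

  Maximal : Sub W → W → Set
  Maximal X m = X m × (∀ y → R m y → X y → R y m)

  Minimal : Sub W → W → Set
  Minimal X m = X m × (∀ y → R y m → X y → R m y)

  ↓ : Sub W → Sub W
  ↓ X z = ∃[ w ] (X w × z ≼ w)

module Duality (𝔉 : TemporalFrame) (𝔐 : Frame.Model 𝔉) where
  open TemporalFrame 𝔉
  open Frame 𝔉
  open Model 𝔐
  open InModel 𝔐
  module ᵒᵖ = Frame.InModel (opposite 𝔉) (opposite-model 𝔐)

  ⟦⟧ᵒᵖ≐⟦mirror⟧ : ∀ φ → ᵒᵖ.⟦ φ ⟧ᴹ ≐ ⟦ mirror φ ⟧ᴹ
  ⟦⟧ᵒᵖ≐⟦mirror⟧ φ = ⟦mirror⟧ φ R val

  ⟦⟧≐⟦mirror⟧ᵒᵖ : ∀ φ → ⟦ φ ⟧ᴹ ≐ ᵒᵖ.⟦ mirror φ ⟧ᴹ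
  ⟦⟧≐⟦mirror⟧ᵒᵖ φ = ⟦mirror⟧ φ (flip R) val

  definable⇒definableᵒᵖ : ∀ {X} → Definable X → ᵒᵖ.Definable X
  definable⇒definableᵒᵖ (φ , X≐φ) = mirror φ , ≐-trans X≐φ (⟦⟧≐⟦mirror⟧ᵒᵖ φ)

  definableᵒᵖ⇒definable : ∀ {X} → ᵒᵖ.Definable X → Definable X
  definableᵒᵖ⇒definable (φ , X≐φ) = mirror φ , ≐-trans X≐φ (⟦⟧ᵒᵖ≐⟦mirror⟧ φ)

  Clusterᵒᵖ≐Cluster : ∀ x → ᵒᵖ.Cluster x ≐ Cluster x
  Clusterᵒᵖ≐Cluster x y = Sum.map₂ swap , Sum.map₂ swap

  MinimalCl⇒MaximalClᵒᵖ : ∀ {x} → MinimalCl x → ᵒᵖ.MaximalCl x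
  MinimalCl⇒MaximalClᵒᵖ (a , x~a , μ , μa , min) =
    a , Sum.map₂ swap x~a , mirror μ , proj₁ (⟦⟧≐⟦mirror⟧ᵒᵖ μ a) μa ,
    λ y yRa μy → min y yRa (proj₂ (⟦⟧≐⟦mirror⟧ᵒᵖ μ y) μy)

  MaximalClᵒᵖ⇒MinimalCl : ∀ {x} → ᵒᵖ.MaximalCl x → MinimalCl x
  MaximalClᵒᵖ⇒MinimalCl (a , x~a , μ , μa , max) =
    a , Sum.map₂ swap x~a , mirror μ , proj₁ (⟦⟧ᵒᵖ≐⟦mirror⟧ μ a) μa ,
    λ y yRa μy → max y yRa (proj₂ (⟦⟧ᵒᵖ≐⟦mirror⟧ μ y) μy)

  HasImmR⁻Succ⇒HasImmRSuccᵒᵖ : ∀ {x} → HasImmR⁻Succ x → ᵒᵖ.HasImmRSucc x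
  HasImmR⁻Succ⇒HasImmRSuccᵒᵖ (y , y<x , ¬between) = y , y<x , ¬between ∘ Product.map₂ swap

  HasImmRSuccᵒᵖ⇒HasImmR⁻Succ : ∀ {x} → ᵒᵖ.HasImmRSucc x → HasImmR⁻Succ x
  HasImmRSuccᵒᵖ⇒HasImmR⁻Succ (y , y<x , ¬between) = y , y<x , ¬between ∘ Product.map₂ swap

  Intervalᵒᵖ⇒Interval : ∀ {x y z} → ᵒᵖ.Interval y x z → Interval x y z
  Intervalᵒᵖ⇒Interval (inj₁ y~z)            = inj₂ (inj₁ (Sum.map₂ swap y~z))
  Intervalᵒᵖ⇒Interval (inj₂ (inj₁ x~z))     = inj₁ (Sum.map₂ swap x~z)
  Intervalᵒᵖ⇒Interval (inj₂ (inj₂ between)) = inj₂ (inj₂ (swap between))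

module _ (lem : ExcludedMiddle lzero) (lem₁ : ExcludedMiddle (lsuc lzero)) where

  private
    dne : {A : Set} → ¬ ¬ A → A
    dne = em⇒dne lem

  module Separation (𝔉 : TemporalFrame) (D : Frame.Descriptive 𝔉) where
    open TemporalFrame 𝔉
    open Frame 𝔉
    open Descriptive D
    open Order 𝔉

    ¬R⇒separated : ∀ {x y} → ¬ R x y → ∃[ X ] (𝒫 X × X y × ¬ ◇Fˢ R X x)
    ¬R⇒separated {x} {y} ¬xRy = em⇒dne lem₁ λ ¬separated →
      ¬xRy (proj₂ (tig x y) λ X X∈𝒫 Xy →
        dne λ ¬◇Xx → ¬separated (X , X∈𝒫 , Xy , ¬◇Xx))

    tig-opposite : ∀ x y → (R y x → ∀ X → 𝒫 X → X y → ◇Pˢ R X x)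
                         × ((∀ X → 𝒫 X → X y → ◇Pˢ R X x) → R y x)
    tig-opposite x y = (λ yRx X _ Xy → y , Xy , yRx) , from
      where
        from : (∀ X → 𝒫 X → X y → ◇Pˢ R X x) → R y x
        from past = dne λ ¬yRx →
          let (X , X∈𝒫 , Xx , ¬◇Xy) = ¬R⇒separated ¬yRx
              (z , ¬◇Xz , zRx) = past (∁ˢ (◇Fˢ R X)) (𝒫-∁ (𝒫-◇F X∈𝒫)) ¬◇Xy
          in ¬◇Xz (x , Xx , zRx)

    ¬≼⇒separated : ∀ {z w} → ¬ z ≼ w → ∃[ X ] (𝒫 X × (∀ q → z ≼ q → X q) × ¬ X w)
    ¬≼⇒separated {z} {w} z⋠w with dif w z (λ { refl → z⋠w refl }) | ¬R⇒separated (z⋠w ∘ [_])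
    ... | Y , Y∈𝒫 , Yw , ¬Yz | X , X∈𝒫 , Xw , ¬◇Xz =
      ∁ˢ (X ∩ˢ Y) , 𝒫-∁ (𝒫-∩ X∈𝒫 Y∈𝒫) , above , λ ¬XYw → ¬XYw (Xw , Yw)
      where
        above : ∀ q → z ≼ q → ∁ˢ (X ∩ˢ Y) q
        above q refl    (_ , Yz) = ¬Yz Yz
        above q [ zRq ] (Xq , _) = ¬◇Xz (q , Xq , zRq)

    maximal-above : ∀ {X x} → 𝒫 X → X x → ∃[ m ] (x ≼ m × Maximal X m)
    maximal-above {X} {x} X∈𝒫 Xx = m , S≼m (Xx , refl) , Xm , maximality
      where
        S : Sub W
        S q = X q × x ≼ q

        Cofinal : Sub W → Set₁
        Cofinal Y = 𝒫 Y × ∃[ z ] (S z × (∀ q → S q → z ≼ q → Y q))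

        common-tail : ∀ L → All Cofinal L →
                      ∃[ p ] (S p × (∀ q → S q → p ≼ q → All (λ Y → Y q) L))
        common-tail []      []                          = x , (Xx , refl) , λ _ _ _ → []
        common-tail (Y ∷ L) ((_ , z , Sz , zY) ∷ cofL) with common-tail L cofL
        ... | p , Sp , pL with connected p z
        ... | inj₁ pRz =
          z , Sz , λ q Sq z≼q → zY q Sq z≼q ∷ pL q Sq (≼-trans [ pRz ] z≼q)
        ... | inj₂ (inj₁ refl) =
          p , Sp , λ q Sq p≼q → zY q Sq p≼q ∷ pL q Sq p≼q
        ... | inj₂ (inj₂ zRp) =
          p , Sp , λ q Sq p≼q → zY q Sq (≼-trans [ zRp ] p≼q) ∷ pL q Sq p≼q

        m∈⋂ : ∃[ m ] (∀ Y → Cofinal Y → Y m)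
        m∈⋂ = com Cofinal (λ _ → proj₁) λ L cofL →
          let (p , Sp , pL) = common-tail L cofL in p , pL p Sp refl

        m : W
        m = proj₁ m∈⋂

        Xm : X m
        Xm = proj₂ m∈⋂ X (X∈𝒫 , x , (Xx , refl) , λ _ Sq _ → proj₁ Sq)

        S≼m : ∀ {z} → S z → z ≼ m
        S≼m Sz = dne λ z⋠m →
          let (Y , Y∈𝒫 , z≼Y , ¬Ym) = ¬≼⇒separated z⋠m
          in ¬Ym (proj₂ m∈⋂ Y (Y∈𝒫 , _ , Sz , λ q _ → z≼Y q))

        maximality : ∀ y → R m y → X y → R y m
        maximality y mRy Xy with S≼m (Xy , ≼-trans (S≼m (Xx , refl)) [ mRy ])
        ... | refl    = mRy
        ... | [ yRm ] = yRm

  opposite-descriptive : {𝔉 : TemporalFrame} → Frame.Descriptive 𝔉 →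
                         Frame.Descriptive (opposite 𝔉)
  opposite-descriptive {𝔉} D = record { dif = dif ; tig = tig-opposite ; com = com }
    where
      open Frame.Descriptive D
      open Separation 𝔉 D

  module _ (𝔉 : TemporalFrame) (D : Frame.Descriptive 𝔉) where
    open TemporalFrame 𝔉
    open Order 𝔉

    minimal-below : ∀ {X x} → 𝒫 X → X x → ∃[ m ] (m ≼ x × Minimal X m)
    minimal-below X∈𝒫 Xx =
      let (m , x≽m , min) = Separation.maximal-above (opposite 𝔉) (opposite-descriptive D) X∈𝒫 Xx
      in m , reflClosure-flip x≽m , min

  module Clusters (𝔉 : TemporalFrame) (𝔐 : Frame.Model 𝔉) where
    open TemporalFrame 𝔉
    open Frame 𝔉
    open Model 𝔐
    open InModel 𝔐
    open Order 𝔉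

    Cluster⇒≼ : ∀ {x z} → Cluster x z → x ≼ z
    Cluster⇒≼ (inj₁ refl)      = refl
    Cluster⇒≼ (inj₂ (xRz , _)) = [ xRz ]

    Cluster⇒≽ : ∀ {x z} → Cluster x z → z ≼ x
    Cluster⇒≽ (inj₁ refl)      = refl
    Cluster⇒≽ (inj₂ (_ , zRx)) = [ zRx ]

    ≼-antisym⇒Cluster : ∀ {x z} → x ≼ z → z ≼ x → Cluster x z
    ≼-antisym⇒Cluster refl    _       = inj₁ refl
    ≼-antisym⇒Cluster [ _ ]   refl    = inj₁ refl
    ≼-antisym⇒Cluster [ xRz ] [ zRx ] = inj₂ (xRz , zRx)

    Cluster≐≼∩≽ : ∀ x → Cluster x ≐ ((x ≼_) ∩ˢ (_≼ x))
    Cluster≐≼∩≽ x z = (λ x~z → Cluster⇒≼ x~z , Cluster⇒≽ x~z)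
                    , (λ (x≼z , z≼x) → ≼-antisym⇒Cluster x≼z z≼x)

    <C≐∁≽ : ∀ x → (x <C_) ≐ ∁ˢ (_≼ x)
    <C≐∁≽ x w = (λ (xRw , ¬wRx) → λ { refl → ¬wRx xRw ; [ wRx ] → ¬wRx wRx }) , ¬≽⇒<C
      where
        ¬≽⇒<C : ¬ w ≼ x → x <C w
        ¬≽⇒<C w⋠x with connected x w
        ... | inj₁ xRw         = xRw , w⋠x ∘ [_]
        ... | inj₂ (inj₁ refl) = ⊥-elim (w⋠x refl)
        ... | inj₂ (inj₂ wRx)  = ⊥-elim (w⋠x [ wRx ])

    Interval≐≼∩≼ : ∀ {x y} → R x y → Interval x y ≐ ((x ≼_) ∩ˢ (_≼ y))
    Interval≐≼∩≼ {x} {y} xRy z = to , from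
      where
        to : Interval x y z → x ≼ z × z ≼ y
        to (inj₁ x~z)                         = Cluster⇒≼ x~z , [ ≼-R-trans (Cluster⇒≽ x~z) xRy ]
        to (inj₂ (inj₁ y~z))                  = [ R-≼-trans xRy (Cluster⇒≼ y~z) ] , Cluster⇒≽ y~z
        to (inj₂ (inj₂ ((xRz , _) , zRy , _))) = [ xRz ] , [ zRy ]

        from : x ≼ z × z ≼ y → Interval x y z
        from (x≼z , z≼y) with lem {z ≼ x} | lem {y ≼ z}
        ... | yes z≼x | _       = inj₁ (≼-antisym⇒Cluster x≼z z≼x)
        ... | no _    | yes y≼z = inj₂ (inj₁ (≼-antisym⇒Cluster y≼z z≼y))
        ... | no z⋠x  | no y⋠z  =
          inj₂ (inj₂ (proj₂ (<C≐∁≽ x z) z⋠x , proj₂ (<C≐∁≽ z y) y⋠z))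

    ↓-Maximal : ∀ {X x a} → Cluster x a → Maximal X a → (_≼ x) ≐ ↓ X
    ↓-Maximal {X} {x} {a} x~a (Xa , max) z = (λ z≼x → a , Xa , ≼-trans z≼x (Cluster⇒≼ x~a)) , below
      where
        below : ↓ X z → z ≼ x
        below (w , Xw , z≼w) with connected x z
        ... | inj₂ (inj₁ refl) = refl
        ... | inj₂ (inj₂ zRx)  = [ zRx ]
        ... | inj₁ xRz         =
          let wRa = max w (R-≼-trans (≼-R-trans (Cluster⇒≽ x~a) xRz) z≼w) Xw
          in ≼-trans z≼w (≼-trans [ wRa ] (Cluster⇒≽ x~a))

    ⟦⟧∈𝒫 : ∀ φ → 𝒫 ⟦ φ ⟧ᴹ
    ⟦⟧∈𝒫 (var p)  = val∈𝒫 p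
    ⟦⟧∈𝒫 ⊤ᶠ       = 𝒫-W
    ⟦⟧∈𝒫 ⊥ᶠ       = 𝒫-∅
    ⟦⟧∈𝒫 (¬ᶠ φ)   = 𝒫-∁ (⟦⟧∈𝒫 φ)
    ⟦⟧∈𝒫 (φ ∧ᶠ ψ) = 𝒫-∩ (⟦⟧∈𝒫 φ) (⟦⟧∈𝒫 ψ)
    ⟦⟧∈𝒫 (◇F φ)   = 𝒫-◇F (⟦⟧∈𝒫 φ)
    ⟦⟧∈𝒫 (◇P φ)   = 𝒫-◇P (⟦⟧∈𝒫 φ)

    ⟦◇F⁼⟧ : ∀ φ → ⟦ ◇F⁼ φ ⟧ᴹ ≐ ↓ ⟦ φ ⟧ᴹ
    ⟦◇F⁼⟧ φ z = to , from
      where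
        to : ⟦ ◇F⁼ φ ⟧ᴹ z → ↓ ⟦ φ ⟧ᴹ z
        to ¬¬↓ = dne λ ¬↓ → ¬¬↓ ( (λ φz → ¬↓ (z , φz , refl))
                               , (λ (w , φw , zRw) → ¬↓ (w , φw , [ zRw ])) )

        from : ↓ ⟦ φ ⟧ᴹ z → ⟦ ◇F⁼ φ ⟧ᴹ z
        from (w , φw , refl)    (¬φz , _)  = ¬φz φw
        from (w , φw , [ zRw ]) (_ , ¬◇φz) = ¬◇φz (w , φw , zRw)

    definable⇒∈𝒫 : ∀ {X} → Definable X → 𝒫 X
    definable⇒∈𝒫 (φ , X≐φ) = 𝒫-ext (⟦⟧∈𝒫 φ) (≐-sym X≐φ)

    definable-≐ : ∀ {X Y} → X ≐ Y → Definable Y → Definable X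
    definable-≐ X≐Y (φ , Y≐φ) = φ , ≐-trans X≐Y Y≐φ

    definable-∩ : ∀ {X Y} → Definable X → Definable Y → Definable (X ∩ˢ Y)
    definable-∩ (φ , X≐φ) (ψ , Y≐ψ) =
      φ ∧ᶠ ψ , λ w → Product.map (proj₁ (X≐φ w)) (proj₁ (Y≐ψ w))
                   , Product.map (proj₂ (X≐φ w)) (proj₂ (Y≐ψ w))

  module MaximalClusters (𝔉 : TemporalFrame) (D : Frame.Descriptive 𝔉) (𝔐 : Frame.Model 𝔉)
    (𝒫-definable : ∀ X → TemporalFrame.𝒫 𝔉 X → Frame.InModel.Definable 𝔉 𝔐 X) where
    open TemporalFrame 𝔉
    open Frame 𝔉
    open Descriptive D
    open InModel 𝔐
    open Order 𝔉
    open Separation 𝔉 D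
    open Clusters 𝔉 𝔐

    Maximal⇒MaximalPt : ∀ {X a} → 𝒫 X → Maximal X a → ∃[ μ ] MaximalPt μ a
    Maximal⇒MaximalPt {X} {a} X∈𝒫 (Xa , max) =
      let (μ , X≐μ) = 𝒫-definable X X∈𝒫
      in μ , proj₁ (X≐μ a) Xa , λ y aRy μy → max y aRy (proj₂ (X≐μ y) μy)

    irreflexive⇒MaximalCl : ∀ {x} → ¬ R x x → MaximalCl x
    irreflexive⇒MaximalCl {x} ¬xRx =
      let (X , X∈𝒫 , Xx , ¬◇Xx) = ¬R⇒separated ¬xRx
      in x , inj₁ refl , Maximal⇒MaximalPt X∈𝒫 (Xx , λ y xRy Xy → ⊥-elim (¬◇Xx (y , Xy , xRy)))

    definable⇒MaximalCl : ∀ {x} → Definable (Cluster x) → MaximalCl x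
    definable⇒MaximalCl {x} x~-definable =
      x , inj₁ refl , Maximal⇒MaximalPt (definable⇒∈𝒫 x~-definable) (inj₁ refl , back)
      where
        back : ∀ y → R x y → Cluster x y → R y x
        back y xRy (inj₁ refl)      = xRy
        back y _   (inj₂ (_ , yRx)) = yRx

    MaximalCl⇒downset-definable : ∀ {x} → MaximalCl x → Definable (_≼ x)
    MaximalCl⇒downset-definable (a , x~a , μ , μ-max) =
      ◇F⁼ μ , ≐-trans (↓-Maximal x~a μ-max) (≐-sym (⟦◇F⁼⟧ μ))

    MaximalCl⇒strict-upset∈𝒫 : ∀ {x} → MaximalCl x → 𝒫 (x <C_)
    MaximalCl⇒strict-upset∈𝒫 {x} x-max =
      𝒫-ext (𝒫-∁ (definable⇒∈𝒫 (MaximalCl⇒downset-definable x-max))) (≐-sym (<C≐∁≽ x))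

    maximal-strictly-below : ∀ {x y} → x <C y →
                             ∃[ m ] (x ≼ m × m <C y × ∃[ μ ] MaximalPt μ m)
    maximal-strictly-below {x} {y} (xRy , ¬yRx)
      with ¬R⇒separated ¬yRx | dif x y (λ { refl → ¬yRx xRy })
    ... | X , X∈𝒫 , Xx , ¬◇Xy | Z , Z∈𝒫 , Zx , ¬Zy
      with maximal-above (𝒫-∩ X∈𝒫 Z∈𝒫) (Xx , Zx)
    ... | m , x≼m , m-max@((Xm , Zm) , _) = m , x≼m , m<y , Maximal⇒MaximalPt (𝒫-∩ X∈𝒫 Z∈𝒫) m-max
      where
        ¬yRm : ¬ R y m
        ¬yRm yRm = ¬◇Xy (m , Xm , yRm)

        m<y : m <C y
        m<y with connected m y
        ... | inj₁ mRy         = mRy , ¬yRm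
        ... | inj₂ (inj₁ refl) = ⊥-elim (¬Zy Zm)
        ... | inj₂ (inj₂ yRm)  = ⊥-elim (¬yRm yRm)

    RFinal⊎HasImmRSucc⇒MaximalCl : ∀ {x} → RFinal x ⊎ HasImmRSucc x → MaximalCl x
    RFinal⊎HasImmRSucc⇒MaximalCl {x} (inj₁ final) =
      x , inj₁ refl , Maximal⇒MaximalPt 𝒫-W (tt , λ y xRy _ → dne λ ¬yRx → final (y , xRy , ¬yRx))
    RFinal⊎HasImmRSucc⇒MaximalCl {x} (inj₂ (y , x<y , ¬between)) =
      let (m , x≼m , m<y , m-max) = maximal-strictly-below x<y
      in m , in-cluster x≼m m<y , m-max
      where
        in-cluster : ∀ {m} → x ≼ m → m <C y → Cluster x m
        in-cluster {m} x≼m m<y with lem {m ≼ x}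
        ... | yes m≼x = ≼-antisym⇒Cluster x≼m m≼x
        ... | no m⋠x  = ⊥-elim (¬between (m , proj₂ (<C≐∁≽ x m) m⋠x , m<y))

    MaximalCl⇒RFinal⊎HasImmRSucc : ∀ {x} → MaximalCl x → RFinal x ⊎ HasImmRSucc x
    MaximalCl⇒RFinal⊎HasImmRSucc {x} x-max with lem {RFinal x}
    ... | yes final = inj₁ final
    ... | no ¬final = inj₂ (immediate (dne ¬final))
      where
        immediate : ∃[ y ] (x <C y) → HasImmRSucc x
        immediate (y , x<y) =
          let (m , _ , x<m , min) = minimal-below 𝔉 D (MaximalCl⇒strict-upset∈𝒫 x-max) x<y
          in m , x<m , λ (z , x<z , zRm , ¬mRz) → ¬mRz (min z zRm x<z)

    Interval-contains-MaximalCl : ∀ {x y} → x <C y → ∃[ z ] (Interval x y z × MaximalCl z)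
    Interval-contains-MaximalCl x<y@(xRy , _) =
      let (m , x≼m , (mRy , _) , m-max) = maximal-strictly-below x<y
      in m , proj₂ (Interval≐≼∩≼ xRy m) (x≼m , [ mRy ]) , m , inj₁ refl , m-max

  module MinimalClusters (𝔉 : TemporalFrame) (D : Frame.Descriptive 𝔉) (𝔐 : Frame.Model 𝔉)
    (𝒫-definable : ∀ X → TemporalFrame.𝒫 𝔉 X → Frame.InModel.Definable 𝔉 𝔐 X) where
    open TemporalFrame 𝔉
    open Frame 𝔉
    open InModel 𝔐
    open Order 𝔉
    open Clusters 𝔉 𝔐
    open Duality 𝔉 𝔐

    private
      module Dual = MaximalClusters (opposite 𝔉) (opposite-descriptive D) (opposite-model 𝔐)
                      (λ X → definable⇒definableᵒᵖ ∘ 𝒫-definable X)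

    irreflexive⇒MinimalCl : ∀ {x} → ¬ R x x → MinimalCl x
    irreflexive⇒MinimalCl = MaximalClᵒᵖ⇒MinimalCl ∘ Dual.irreflexive⇒MaximalCl

    definable⇒MinimalCl : ∀ {x} → Definable (Cluster x) → MinimalCl x
    definable⇒MinimalCl {x} =
      MaximalClᵒᵖ⇒MinimalCl ∘ Dual.definable⇒MaximalCl
        ∘ definable⇒definableᵒᵖ ∘ definable-≐ (Clusterᵒᵖ≐Cluster x)

    MinimalCl⇒upset-definable : ∀ {x} → MinimalCl x → Definable (x ≼_)
    MinimalCl⇒upset-definable =
      definable-≐ (λ _ → reflClosure-flip , reflClosure-flip) ∘ definableᵒᵖ⇒definable
        ∘ Dual.MaximalCl⇒downset-definable ∘ MinimalCl⇒MaximalClᵒᵖ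

    R⁻Final⊎HasImmR⁻Succ⇒MinimalCl : ∀ {x} → R⁻Final x ⊎ HasImmR⁻Succ x → MinimalCl x
    R⁻Final⊎HasImmR⁻Succ⇒MinimalCl =
      MaximalClᵒᵖ⇒MinimalCl ∘ Dual.RFinal⊎HasImmRSucc⇒MaximalCl ∘ Sum.map₂ HasImmR⁻Succ⇒HasImmRSuccᵒᵖ

    MinimalCl⇒R⁻Final⊎HasImmR⁻Succ : ∀ {x} → MinimalCl x → R⁻Final x ⊎ HasImmR⁻Succ x
    MinimalCl⇒R⁻Final⊎HasImmR⁻Succ =
      Sum.map₂ HasImmRSuccᵒᵖ⇒HasImmR⁻Succ ∘ Dual.MaximalCl⇒RFinal⊎HasImmRSucc ∘ MinimalCl⇒MaximalClᵒᵖ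

    Interval-contains-MinimalCl : ∀ {x y} → x <C y → ∃[ z ] (Interval x y z × MinimalCl z)
    Interval-contains-MinimalCl x<y =
      let (z , z∈[y,x]ᵒᵖ , z-max) = Dual.Interval-contains-MaximalCl x<y
      in z , Intervalᵒᵖ⇒Interval z∈[y,x]ᵒᵖ , MaximalClᵒᵖ⇒MinimalCl z-max

  module DefinableClusters (𝔉 : TemporalFrame) (D : Frame.Descriptive 𝔉) (𝔐 : Frame.Model 𝔉)
    (𝒫-definable : ∀ X → TemporalFrame.𝒫 𝔉 X → Frame.InModel.Definable 𝔉 𝔐 X) where
    open Frame 𝔉
    open InModel 𝔐
    open Clusters 𝔉 𝔐
    open MaximalClusters 𝔉 D 𝔐 𝒫-definable public
    open MinimalClusters 𝔉 D 𝔐 𝒫-definable public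

    Degenerate⇒MaximalCl×MinimalCl : ∀ {x} → Degenerate x → MaximalCl x × MinimalCl x
    Degenerate⇒MaximalCl×MinimalCl (_ , ¬xRx) = irreflexive⇒MaximalCl ¬xRx , irreflexive⇒MinimalCl ¬xRx

    definable⇒MaximalCl×MinimalCl : ∀ {x} → Definable (Cluster x) → MaximalCl x × MinimalCl x
    definable⇒MaximalCl×MinimalCl x~-definable =
      definable⇒MaximalCl x~-definable , definable⇒MinimalCl x~-definable

    MaximalCl×MinimalCl⇒definable : ∀ {x} → MaximalCl x × MinimalCl x → Definable (Cluster x)
    MaximalCl×MinimalCl⇒definable {x} (x-max , x-min) =
      definable-≐ (Cluster≐≼∩≽ x)
        (definable-∩ (MinimalCl⇒upset-definable x-min) (MaximalCl⇒downset-definable x-max))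

    ¬R⁻Limit⇒MaximalCl : ∀ {x} → ¬ R⁻Limit x → MaximalCl x
    ¬R⁻Limit⇒MaximalCl {x} ¬limit with lem {RFinal x}
    ... | yes final = RFinal⊎HasImmRSucc⇒MaximalCl (inj₁ final)
    ... | no ¬final = RFinal⊎HasImmRSucc⇒MaximalCl (inj₂ (dne λ ¬succ → ¬limit (¬final , ¬succ)))

    ¬RLimit⇒MinimalCl : ∀ {x} → ¬ RLimit x → MinimalCl x
    ¬RLimit⇒MinimalCl {x} ¬limit with lem {R⁻Final x}
    ... | yes final = R⁻Final⊎HasImmR⁻Succ⇒MinimalCl (inj₁ final)
    ... | no ¬final = R⁻Final⊎HasImmR⁻Succ⇒MinimalCl (inj₂ (dne λ ¬succ → ¬limit (¬final , ¬succ)))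

    limit⇒¬MaximalCl×MinimalCl : ∀ {x} → RLimit x ⊎ R⁻Limit x → ¬ (MaximalCl x × MinimalCl x)
    limit⇒¬MaximalCl×MinimalCl (inj₁ (¬final , ¬succ)) (_ , x-min) =
      Sum.[ ¬final , ¬succ ] (MinimalCl⇒R⁻Final⊎HasImmR⁻Succ x-min)
    limit⇒¬MaximalCl×MinimalCl (inj₂ (¬final , ¬succ)) (x-max , _) =
      Sum.[ ¬final , ¬succ ] (MaximalCl⇒RFinal⊎HasImmRSucc x-max)

    Interval-definable : ∀ {x y} → x <C y → ¬ RLimit x → ¬ R⁻Limit y → Definable (Interval x y)
    Interval-definable (xRy , _) ¬limit-x ¬limit-y =
      definable-≐ (Interval≐≼∩≼ xRy)
        (definable-∩ (MinimalCl⇒upset-definable (¬RLimit⇒MinimalCl ¬limit-x))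
                     (MaximalCl⇒downset-definable (¬R⁻Limit⇒MaximalCl ¬limit-y)))

lemma5p4 : ExcludedMiddle lzero → ExcludedMiddle (lsuc lzero) →
    (𝔉 : TemporalFrame) → Frame.Descriptive 𝔉 →
    (𝔐 : Frame.Model 𝔉) → Frame.InModel.FinitelyMGenerated 𝔉 𝔐 →
    let open Frame 𝔉 in let open InModel 𝔐 in
    (∀ x → Degenerate x → MaximalCl x × MinimalCl x)
    × (∀ x → (MaximalCl x → RFinal x ⊎ HasImmRSucc x)
           × (RFinal x ⊎ HasImmRSucc x → MaximalCl x))
    × (∀ x → (MinimalCl x → R⁻Final x ⊎ HasImmR⁻Succ x)
           × (R⁻Final x ⊎ HasImmR⁻Succ x → MinimalCl x))
    × (∀ x → (Definable (Cluster x) → MaximalCl x × MinimalCl x)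
           × (MaximalCl x × MinimalCl x → Definable (Cluster x)))
    × (∀ x → RLimit x ⊎ R⁻Limit x → ¬ Definable (Cluster x) × ¬ Degenerate x)
    × (∀ x → ¬ RLimit x → ¬ R⁻Limit x → Definable (Cluster x))
    × (∀ x y → x <C y → (∃[ z ] (Interval x y z × MaximalCl z))
                       × (∃[ z ] (Interval x y z × MinimalCl z)))
    × (∀ x y → x <C y → ¬ RLimit x → ¬ R⁻Limit y → Definable (Interval x y))
lemma5p4 lem lem₁ 𝔉 D 𝔐 (_ , 𝒫-definable) =
    (λ _ → Degenerate⇒MaximalCl×MinimalCl)
  , (λ _ → MaximalCl⇒RFinal⊎HasImmRSucc , RFinal⊎HasImmRSucc⇒MaximalCl)
  , (λ _ → MinimalCl⇒R⁻Final⊎HasImmR⁻Succ , R⁻Final⊎HasImmR⁻Succ⇒MinimalCl)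
  , (λ _ → definable⇒MaximalCl×MinimalCl , MaximalCl×MinimalCl⇒definable)
  , (λ _ limit → limit⇒¬MaximalCl×MinimalCl limit ∘ definable⇒MaximalCl×MinimalCl
               , limit⇒¬MaximalCl×MinimalCl limit ∘ Degenerate⇒MaximalCl×MinimalCl)
  , (λ _ ¬limit ¬limit⁻ → MaximalCl×MinimalCl⇒definable (¬R⁻Limit⇒MaximalCl ¬limit⁻ , ¬RLimit⇒MinimalCl ¬limit))
  , (λ _ _ x<y → Interval-contains-MaximalCl x<y , Interval-contains-MinimalCl x<y)
  , (λ _ _ → Interval-definable)
  where open DefinableClusters lem lem₁ 𝔉 D 𝔐 𝒫-definable
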